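{- Let $G=(V,E)$ be a connected finite simple graph with $n=|V|$, let $k$ be the largest cardinality of an independent set of $G$, and let $\mathcal G$ be the graph constructed from $G$ as described in the context. Then the largest proper stalled subset of the vertex set of $\mathcal G$ has cardinality $(2n+1)|E|+k$, and the largest proper skew stalled subset of the vertex set of $\mathcal G$ also has cardinality $(2n+1)|E|+k$.
   Context: For a finite simple graph $H$ with vertex set $W$ and a set $F\subseteq W$: an empty vertex $v\in W\setminus F$ is forced by $F$ if there is $u\in F$ such that $v$ is the unique neighbor of $u$ outside $F$; it is skew forced by $F$ if there is $u\in W$ (not necessarily in $F$) such that $v$ is the unique neighbor of $u$ outside $F$. $F$ is stalled (resp. skew stalled) if no vertex of $W\setminus F$ is forced (resp. skew forced) by $F$. $F$ is proper if $F\neq W$. Construction of $\mathcal G$: given $G=(V,E)$ with $n=|V|$, let $E^i=\{e^i : e\in E\}$ for $i=0,1,\dots,2n$ be $2n+1$ pairwise disjoint copies of $E$ (disjoint from $V$), and let $\varepsilon$ be a further new vertex. The vertex set of $\mathcal G$ is $\mathcal V=V\cup E^0\cup\dots\cup E^{2n}\cup\{\varepsilon\}$ (so $|\mathcal V|=(2n+1)|E|+n+1$). The edges of $\mathcal G$ are exactly: for every edge $e=\{u,v\}\in E$, the edges $\{u,e^0\}$ and $\{e^0,v\}$; the edges $\{e^i,e^{i+1}\}$ for $0\le i\le 2n-1$; and the edge $\{\varepsilon,e^0\}$. -}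

module Defs where

open import Data.Nat using (ℕ; zero; suc; _+_; _*_; _≤_)
open import Data.Fin using (Fin; zero; suc; splitAt; remQuot; inject₁) renaming (_<_ to _<ᶠ_)
open import Data.Fin.Subset using (Subset; _∈_; _∉_; ∣_∣; ⊤)
open import Data.List using (List; length; lookup)
open import Data.List.Membership.Propositional using () renaming (_∈_ to _∈ˡ_)
open import Data.List.Relation.Unary.All using (All)
open import Data.List.Relation.Unary.Unique.Propositional using (Unique)
open import Data.Product using (Σ; ∃; _×_; _,_; proj₁; proj₂)
open import Data.Sum using (_⊎_; inj₁; inj₂)
open import Relation.Nullary using (¬_)
open import Relation.Binary.PropositionalEquality using (_≡_; _≢_)

-- Generic notions for a graph on vertex set Fin N given by an
-- adjacency relation Adj (assumed symmetric and irreflexive where used).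

module _ {N : ℕ} (Adj : Fin N → Fin N → Set) where

  UniqueOutNbr : Subset N → Fin N → Fin N → Set
  UniqueOutNbr F u v = Adj u v × v ∉ F × (∀ w → Adj u w → w ∉ F → w ≡ v)

  Forced : Subset N → Fin N → Set
  Forced F v = v ∉ F × Σ (Fin N) (λ u → u ∈ F × UniqueOutNbr F u v)

  SkewForced : Subset N → Fin N → Set
  SkewForced F v = v ∉ F × Σ (Fin N) (λ u → UniqueOutNbr F u v)

  Stalled : Subset N → Set
  Stalled F = ∀ v → ¬ Forced F v

  SkewStalled : Subset N → Set
  SkewStalled F = ∀ v → ¬ SkewForced F v

  Independent : Subset N → Set
  Independent I = ∀ u v → u ∈ I → v ∈ I → ¬ Adj u v

Proper : {N : ℕ} → Subset N → Set
Proper F = F ≢ ⊤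

IsMaxCard : {N : ℕ} → (Subset N → Set) → ℕ → Set
IsMaxCard {N} P c = Σ (Subset N) (λ F → P F × ∣ F ∣ ≡ c) × (∀ F → P F → ∣ F ∣ ≤ c)

SimpleEdgeList : (n : ℕ) → List (Fin n × Fin n) → Set
SimpleEdgeList n es = All (λ e → proj₁ e <ᶠ proj₂ e) es × Unique es

AdjG : {n : ℕ} → List (Fin n × Fin n) → Fin n → Fin n → Set
AdjG es u v = (u , v) ∈ˡ es ⊎ (v , u) ∈ˡ es

data Reach {n : ℕ} (es : List (Fin n × Fin n)) : Fin n → Fin n → Set where
  here : ∀ {u} → Reach es u u
  step : ∀ {u v w} → AdjG es u v → Reach es v w → Reach es u w

Connected : {n : ℕ} → List (Fin n × Fin n) → Set
Connected {n} es = ∀ (u v : Fin n) → Reach es u v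

-- The construction 𝒢.  With m = |E|, vertices are
--   vert u (u ∈ V),  edg i j  (= e_j^i, i ∈ {0..2n}, j indexes E),  eps (= ε).

data CV (n m : ℕ) : Set where
  vert : Fin n → CV n m
  edg  : Fin (suc (2 * n)) → Fin m → CV n m
  eps  : CV n m

data CDir {n : ℕ} (es : List (Fin n × Fin n)) : CV n (length es) → CV n (length es) → Set where
  endL : ∀ j → CDir es (vert (proj₁ (lookup es j))) (edg zero j)
  endR : ∀ j → CDir es (vert (proj₂ (lookup es j))) (edg zero j)
  path : ∀ (i : Fin (2 * n)) j → CDir es (edg (inject₁ i) j) (edg (suc i) j)
  toε  : ∀ j → CDir es eps (edg zero j)

CAdj : {n : ℕ} (es : List (Fin n × Fin n)) → CV n (length es) → CV n (length es) → Set
CAdj es x y = CDir es x y ⊎ CDir es y x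

𝒱size : (n m : ℕ) → ℕ
𝒱size n m = n + suc (2 * n) * m + 1

decode : (n m : ℕ) → Fin (𝒱size n m) → CV n m
decode n m x with splitAt (n + suc (2 * n) * m) x
... | inj₂ _ = eps
... | inj₁ y with splitAt n y
...   | inj₁ u = vert u
...   | inj₂ z = edg (proj₁ (remQuot {suc (2 * n)} m z)) (proj₂ (remQuot {suc (2 * n)} m z))

𝒢Adj : {n : ℕ} (es : List (Fin n × Fin n)) →
       Fin (𝒱size n (length es)) → Fin (𝒱size n (length es)) → Set
𝒢Adj {n} es x y = CAdj es (decode n (length es) x) (decode n (length es) y)

-- Lower bound: fill all edge copies eⁱ and a maximum independent set I of G, and leave ε empty.
-- The empty vertices are vertices of G and ε, whose neighbours are apexes e⁰; every apex has the
-- empty neighbour ε and, I being independent, an empty endpoint, so nothing is (skew) forced.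
-- Upper bound: in a stalled set, two adjacent filled vertices of a column e⁰ — ⋯ — e²ⁿ force the
-- whole column, so a column that is not full has at most n + 1 filled vertices and then
-- |F| ≤ n + ((2n+1)|E| − n) + 1 ≤ (2n+1)|E| + k.  If all columns are full and ε is empty, the filled
-- vertices of G form an independent set; if ε is filled as well, each apex forces its two
-- endpoints to agree, so by connectivity and properness no vertex of G is filled.
module Submission where

open import Defs
open import Data.Bool using (Bool; true; false)
open import Data.Bool.Properties using (¬-not; ⇔→≡) renaming (_≟_ to _≟ᵇ_)
open import Data.Empty using (⊥; ⊥-elim)
open import Data.Fin using (Fin; zero; suc; toℕ; inject₁; _↑ˡ_; _↑ʳ_; combine; splitAt; join)
open import Data.Fin.Properties
  using (toℕ-inject₁; toℕ-fromℕ; toℕ≤pred[n]; inject₁-injective; splitAt-↑ˡ; splitAt-↑ʳ;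
         join-splitAt; remQuot-combine; combine-remQuot; all?; ¬∀⟶∃¬)
  renaming (<-irrefl to <ᶠ-irrefl; 0≢1+n to 0≢1+nᶠ; suc-injective to suc-injectiveᶠ)
open import Data.Fin.Subset using (Subset; ∣_∣; ⁅_⁆; _∈_; _∉_)
open import Data.Fin.Subset.Properties using (∣⁅x⁆∣≡1; x∈⁅y⁆⇒x≡y; ⊆-antisym; ⊆⊤)
open import Data.List using (List; length)
import Data.List as List
open import Data.List.Membership.Propositional.Properties using (∈-lookup)
import Data.List.Relation.Unary.All as All
import Data.List.Relation.Unary.Any as Any
open import Data.List.Relation.Unary.Any.Properties using (lookup-index)
open import Data.Nat using (ℕ; zero; suc; _+_; _*_; _≤_; z≤n; s≤s)
open import Data.Nat.Properties
open import Algebra.Properties.CommutativeSemigroup +-commutativeSemigroup using (xy∙z≈xz∙y; xy∙z≈y∙xz)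
open import Algebra.Properties.CommutativeMonoid.Sum +-0-commutativeMonoid
  using (sum; sum-syntax; sum-cong-≗; sum-init-last; ∑-comm)
open import Data.Product using (Σ; _×_; _,_; proj₁; proj₂; map₂)
open import Data.Sum using (_⊎_; inj₁; inj₂; [_,_]′; swap)
open import Data.Vec as Vec using (tabulate)
open import Data.Vec.Properties using (lookup⇒[]=; []=⇒lookup; lookup∘tabulate; lookup-replicate)
open import Function using (_∘_; mk⇔)
open import Relation.Nullary using (¬_; yes; no)
open import Relation.Binary.PropositionalEquality

sum-↑ : ∀ a {b} (g : Fin (a + b) → ℕ) → sum g ≡ ∑[ i < a ] g (i ↑ˡ b) + ∑[ i < b ] g (a ↑ʳ i)
sum-↑ zero g = refl
sum-↑ (suc a) g = trans (cong (g zero +_) (sum-↑ a (g ∘ suc))) (sym (+-assoc (g zero) _ _))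

sum-combine : ∀ a {b} (g : Fin (a * b) → ℕ) → sum g ≡ ∑[ i < a ] ∑[ j < b ] g (combine i j)
sum-combine zero g = refl
sum-combine (suc a) {b} g =
  trans (sum-↑ b g) (cong (∑[ j < b ] g (j ↑ˡ a * b) +_) (sum-combine a (g ∘ (b ↑ʳ_))))

sum-const : ∀ k c → ∑[ i < k ] c ≡ k * c
sum-const zero    c = refl
sum-const (suc k) c = cong (c +_) (sum-const k c)

sum-mono-≤ : ∀ {k} {g h : Fin k → ℕ} → (∀ i → g i ≤ h i) → sum g ≤ sum h
sum-mono-≤ {zero}  g≤h = z≤n
sum-mono-≤ {suc k} g≤h = +-mono-≤ (g≤h zero) (sum-mono-≤ (g≤h ∘ suc))

sum-mono-≤-slack : ∀ {k} {g h : Fin k → ℕ} d → (∀ i → g i ≤ h i) →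
                   (j : Fin k) → g j + d ≤ h j → sum g + d ≤ sum h
sum-mono-≤-slack {g = g} {h} d g≤h zero gj+d≤hj = begin
  g zero + sum (g ∘ suc) + d   ≡⟨ xy∙z≈xz∙y (g zero) _ d ⟩
  g zero + d + sum (g ∘ suc)   ≤⟨ +-mono-≤ gj+d≤hj (sum-mono-≤ (g≤h ∘ suc)) ⟩
  h zero + sum (h ∘ suc)       ∎
  where open ≤-Reasoning
sum-mono-≤-slack {g = g} {h} d g≤h (suc j) gj+d≤hj = begin
  g zero + sum (g ∘ suc) + d   ≡⟨ +-assoc (g zero) _ d ⟩
  g zero + (sum (g ∘ suc) + d) ≤⟨ +-mono-≤ (g≤h zero) (sum-mono-≤-slack d (g≤h ∘ suc) j gj+d≤hj) ⟩
  h zero + sum (h ∘ suc)       ∎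
  where open ≤-Reasoning

true≢false : true ≢ false
true≢false ()

fromBool : Bool → ℕ
fromBool true  = 1
fromBool false = 0

fromBool≤1 : ∀ b → fromBool b ≤ 1
fromBool≤1 true  = s≤s z≤n
fromBool≤1 false = z≤n

count : ∀ {k} → (Fin k → Bool) → ℕ
count p = sum (fromBool ∘ p)

count≤ : ∀ {k} (p : Fin k → Bool) → count p ≤ k
count≤ {k} p = subst (sum (fromBool ∘ p) ≤_) (trans (sum-const k 1) (*-identityʳ k))
                     (sum-mono-≤ (fromBool≤1 ∘ p))

count-true : ∀ {k} (p : Fin k → Bool) → (∀ i → p i ≡ true) → count p ≡ k
count-true {k} p all = trans (sum-cong-≗ (cong fromBool ∘ all)) (trans (sum-const k 1) (*-identityʳ k))

count-false : ∀ {k} (p : Fin k → Bool) → (∀ i → p i ≡ false) → count p ≡ 0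
count-false {k} p none = trans (sum-cong-≗ (cong fromBool ∘ none)) (trans (sum-const k 0) (*-zeroʳ k))

allTrue⊎someFalse : ∀ {k} (p : Fin k → Bool) → (∀ i → p i ≡ true) ⊎ Σ (Fin k) (λ i → p i ≡ false)
allTrue⊎someFalse {k} p with all? (λ i → p i ≟ᵇ true)
... | yes allTrue = inj₁ allTrue
... | no ¬allTrue = inj₂ (map₂ ¬-not (¬∀⟶∃¬ k _ (λ i → p i ≟ᵇ true) ¬allTrue))

allTrue⊎someFalse₂ : ∀ {a b} (p : Fin a → Fin b → Bool) →
                     (∀ i j → p i j ≡ true) ⊎ Σ (Fin a) λ i → Σ (Fin b) λ j → p i j ≡ false
allTrue⊎someFalse₂ {a} p with all? (λ i → all? (λ j → p i j ≟ᵇ true))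
... | yes allTrue = inj₁ allTrue
... | no ¬allTrue with ¬∀⟶∃¬ a _ (λ i → all? (λ j → p i j ≟ᵇ true)) ¬allTrue
...   | i , ¬allTrueᵢ with allTrue⊎someFalse (p i)
...     | inj₁ allTrueᵢ  = ⊥-elim (¬allTrueᵢ allTrueᵢ)
...     | inj₂ (j , pij) = inj₂ (i , j , pij)

∣p∣≡count : ∀ {k} (p : Subset k) → ∣ p ∣ ≡ count (Vec.lookup p)
∣p∣≡count Vec.[]             = refl
∣p∣≡count (true  Vec.∷ p) = cong suc (∣p∣≡count p)
∣p∣≡count (false Vec.∷ p) = ∣p∣≡count p

countUpTo : (ℕ → Bool) → ℕ → ℕ
countUpTo b t = count (b ∘ toℕ {t})

countUpTo-suc : ∀ b t → countUpTo b (suc t) ≡ countUpTo b t + fromBool (b t)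
countUpTo-suc b t = trans (sum-init-last {t} (fromBool ∘ b ∘ toℕ))
  (cong₂ _+_ (sum-cong-≗ {t} (cong (fromBool ∘ b) ∘ toℕ-inject₁)) (cong (fromBool ∘ b) (toℕ-fromℕ t)))

module _ (b : ℕ → Bool) where

  BothTrue : ℕ → Set
  BothTrue i = b i ≡ true × b (suc i) ≡ true

  fromBool-pair≤1 : ∀ i → ¬ BothTrue i → fromBool (b i) + fromBool (b (suc i)) ≤ 1
  fromBool-pair≤1 i ¬both with b i | b (suc i)
  ... | true  | true  = ⊥-elim (¬both (refl , refl))
  ... | true  | false = s≤s z≤n
  ... | false | y     = fromBool≤1 y

  countUpTo-noBothTrue : ∀ n → (∀ i → suc i ≤ 2 * n → ¬ BothTrue i) → countUpTo b (suc (2 * n)) ≤ suc n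
  countUpTo-noBothTrue zero    _      = subst (_≤ 1) (sym (+-identityʳ _)) (fromBool≤1 (b 0))
  countUpTo-noBothTrue (suc n) sparse = begin
    countUpTo b (suc (2 * suc n))               ≡⟨ cong (countUpTo b ∘ suc) (*-suc 2 n) ⟩
    countUpTo b (suc (suc (suc (2 * n))))       ≡⟨ countUpTo-suc b (suc (suc (2 * n))) ⟩
    countUpTo b (suc (suc (2 * n))) + y         ≡⟨ cong (_+ y) (countUpTo-suc b (suc (2 * n))) ⟩
    countUpTo b (suc (2 * n)) + x + y           ≡⟨ +-assoc (countUpTo b (suc (2 * n))) x y ⟩
    countUpTo b (suc (2 * n)) + (x + y)         ≤⟨ +-mono-≤ (countUpTo-noBothTrue n sparse-n) last-pair ⟩
    suc n + 1                                   ≡⟨ +-comm (suc n) 1 ⟩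
    suc (suc n)                                 ∎
    where
    open ≤-Reasoning
    2n+2≡2[1+n] : 2 + 2 * n ≡ 2 * suc n
    2n+2≡2[1+n] = sym (*-suc 2 n)
    sparse-n : ∀ i → suc i ≤ 2 * n → ¬ BothTrue i
    sparse-n i i<2n = sparse i (≤-trans i<2n (≤-trans (m≤n+m (2 * n) 2) (≤-reflexive 2n+2≡2[1+n])))
    x y : ℕ
    x = fromBool (b (suc (2 * n)))
    y = fromBool (b (suc (suc (2 * n))))
    last-pair : x + y ≤ 1
    last-pair = fromBool-pair≤1 _ (sparse _ (≤-reflexive 2n+2≡2[1+n]))

  -- closed: on the path 0 — 1 — ⋯ — L, the two neighbours of a true inner vertex agree.
  module _ {L : ℕ} (closed : ∀ i → suc (suc i) ≤ L → b (suc i) ≡ true → b i ≡ b (suc (suc i))) where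

    bothTrue-pred : ∀ {i} → suc (suc i) ≤ L → BothTrue (suc i) → BothTrue i
    bothTrue-pred {i} i+2≤L (bi+1 , bi+2) = trans (closed i i+2≤L bi+1) bi+2 , bi+1

    bothTrue-suc : ∀ {i} → suc (suc i) ≤ L → BothTrue i → BothTrue (suc i)
    bothTrue-suc {i} i+2≤L (bi , bi+1) = bi+1 , trans (sym (closed i i+2≤L bi+1)) bi

    bothTrue-zero : ∀ p → suc p ≤ L → BothTrue p → BothTrue 0
    bothTrue-zero zero    _      both = both
    bothTrue-zero (suc p) p+2≤L both = bothTrue-zero p (<⇒≤ p+2≤L) (bothTrue-pred p+2≤L both)

    bothTrue-from-zero : ∀ i → suc i ≤ L → BothTrue 0 → BothTrue i
    bothTrue-from-zero zero    _      both = both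
    bothTrue-from-zero (suc i) i+2≤L both = bothTrue-suc i+2≤L (bothTrue-from-zero i (<⇒≤ i+2≤L) both)

    bothTrue⇒allTrue : ∀ p → suc p ≤ L → BothTrue p → ∀ i → i ≤ L → b i ≡ true
    bothTrue⇒allTrue p p+1≤L both zero    _      = proj₁ (bothTrue-zero p p+1≤L both)
    bothTrue⇒allTrue p p+1≤L both (suc i) i+1≤L =
      proj₂ (bothTrue-from-zero i i+1≤L (bothTrue-zero p p+1≤L both))

    false⇒noBothTrue : ∀ {i₀} → i₀ ≤ L → b i₀ ≡ false → ∀ p → suc p ≤ L → ¬ BothTrue p
    false⇒noBothTrue i₀≤L bi₀ p p+1≤L both = true≢false (trans (sym (bothTrue⇒allTrue p p+1≤L both _ i₀≤L)) bi₀)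

-- f marks the filled vertices.  ForcingClosed is the contrapositive of Stalled: a filled u all of whose
-- neighbours other than v are filled forces v; SkewForcingClosed drops the condition that u is filled.
module _ {V : Set} (Adj : V → V → Set) (f : V → Bool) where

  ForcingClosed : Set
  ForcingClosed = ∀ {u v} → f u ≡ true → Adj u v → (∀ w → Adj u w → w ≡ v ⊎ f w ≡ true) → f v ≡ true

  SkewForcingClosed : Set
  SkewForcingClosed = ∀ {u v} → Adj u v → (∀ w → Adj u w → w ≡ v ⊎ f w ≡ true) → f v ≡ true

  forcingClosed-transfer : ForcingClosed → ∀ {u v w} → f u ≡ true → Adj u w →
                           (∀ x → Adj u x → x ≡ v ⊎ x ≡ w ⊎ f x ≡ true) → f v ≡ true → f w ≡ true
  forcingClosed-transfer closed {v = v} {w} fu uw nbrs fv = closed fu uw λ x ux → reroute (nbrs x ux)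
    where
    reroute : ∀ {x} → x ≡ v ⊎ x ≡ w ⊎ f x ≡ true → x ≡ w ⊎ f x ≡ true
    reroute (inj₁ refl) = inj₂ fv
    reroute (inj₂ x≡w⊎fx) = x≡w⊎fx

  forcingClosed-pair : ForcingClosed → ∀ {u v w} → f u ≡ true → Adj u v → Adj u w →
                       (∀ x → Adj u x → x ≡ v ⊎ x ≡ w ⊎ f x ≡ true) → f v ≡ f w
  forcingClosed-pair closed fu uv uw nbrs = ⇔→≡ (mk⇔
    (forcingClosed-transfer closed fu uw nbrs)
    (forcingClosed-transfer closed fu uv (λ x ux → [ inj₂ ∘ inj₁ , [ inj₁ , inj₂ ∘ inj₂ ]′ ]′ (nbrs x ux))))

lookup≡false⇒∉ : ∀ {k} {F : Subset k} {x} → Vec.lookup F x ≡ false → x ∉ F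
lookup≡false⇒∉ Fx≡false x∈F = true≢false (trans (sym ([]=⇒lookup x∈F)) Fx≡false)

skewStalled⇒stalled : ∀ {N} (Adj : Fin N → Fin N → Set) (F : Subset N) → SkewStalled Adj F → Stalled Adj F
skewStalled⇒stalled Adj F skew v (v∉F , u , _ , unique) = skew v (v∉F , u , unique)

module _ {N : ℕ} {V : Set} (Adj : V → V → Set) (dec : Fin N → V) (enc : V → Fin N)
         (dec∘enc : ∀ c → dec (enc c) ≡ c) (enc∘dec : ∀ x → enc (dec x) ≡ x) where

  private
    Adjᴺ : Fin N → Fin N → Set
    Adjᴺ x y = Adj (dec x) (dec y)

  stalled⇒forcingClosed : (F : Subset N) → Stalled Adjᴺ F → ForcingClosed Adj (Vec.lookup F ∘ enc)
  stalled⇒forcingClosed F stalled {u} {v} Fu uv nbrs with Vec.lookup F (enc v) in Fv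
  ... | true  = refl
  ... | false = ⊥-elim (stalled (enc v) (v∉F , enc u , lookup⇒[]= (enc u) F Fu , uv′ , v∉F , unique))
    where
    v∉F : enc v ∉ F
    v∉F = lookup≡false⇒∉ Fv
    uv′ : Adjᴺ (enc u) (enc v)
    uv′ = subst₂ Adj (sym (dec∘enc u)) (sym (dec∘enc v)) uv
    unique : ∀ w → Adjᴺ (enc u) w → w ∉ F → w ≡ enc v
    unique w uw w∉F with nbrs (dec w) (subst (λ z → Adj z (dec w)) (dec∘enc u) uw)
    ... | inj₁ w≡v = trans (sym (enc∘dec w)) (cong enc w≡v)
    ... | inj₂ Fw  = ⊥-elim (w∉F (lookup⇒[]= w F (trans (cong (Vec.lookup F) (sym (enc∘dec w))) Fw)))

  skewForcingClosed⇒skewStalled : (g : V → Bool) → SkewForcingClosed Adj g → SkewStalled Adjᴺ (tabulate (g ∘ dec))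
  skewForcingClosed⇒skewStalled g closed v (v∉F , u , uv , _ , unique) =
    v∉F (lookup⇒[]= v F (trans (lookup∘tabulate (g ∘ dec) v) (closed uv nbrs)))
    where
    F : Subset N
    F = tabulate (g ∘ dec)
    nbrs : ∀ w → Adj (dec u) w → w ≡ dec v ⊎ g w ≡ true
    nbrs w uw with g w in gw
    ... | true  = inj₂ refl
    ... | false = inj₁ (trans (sym (dec∘enc w)) (cong dec (unique (enc w) uw′ (lookup≡false⇒∉ Fw))))
      where
      uw′ : Adjᴺ u (enc w)
      uw′ = subst (Adj (dec u)) (sym (dec∘enc w)) uw
      Fw : Vec.lookup F (enc w) ≡ false
      Fw = trans (lookup∘tabulate (g ∘ dec) (enc w)) (trans (cong g (dec∘enc w)) gw)

clamp : ∀ L → ℕ → Fin (suc L)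
clamp L       zero    = zero
clamp zero    (suc i) = zero
clamp (suc L) (suc i) = suc (clamp L i)

clamp-toℕ : ∀ {L} (i : Fin (suc L)) → clamp L (toℕ i) ≡ i
clamp-toℕ         zero    = refl
clamp-toℕ {suc L} (suc i) = cong suc (clamp-toℕ i)

clamp-step : ∀ {L i} → suc i ≤ L → Σ (Fin L) λ x → clamp L i ≡ inject₁ x × clamp L (suc i) ≡ suc x
clamp-step {suc L} {zero}  _            = zero , refl , refl
clamp-step {suc L} {suc i} (s≤s i+1≤L) with clamp-step i+1≤L
... | x , i↦x , i+1↦x+1 = suc x , cong suc i↦x , cong suc i+1↦x+1

join-splitAt⁻¹ : ∀ a b {x : Fin (a + b)} {s} → splitAt a x ≡ s → join a b s ≡ x
join-splitAt⁻¹ a b {x} split≡s = trans (cong (join a b) (sym split≡s)) (join-splitAt a b x)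

module Construction {n : ℕ} (es : List (Fin n × Fin n)) where

  m S N : ℕ
  m = length es
  S = suc (2 * n)
  N = 𝒱size n m

  𝒱 : Set
  𝒱 = CV n m

  l r : Fin m → Fin n
  l j = proj₁ (List.lookup es j)
  r j = proj₂ (List.lookup es j)

  encode : 𝒱 → Fin N
  encode (vert u)  = (u ↑ˡ S * m) ↑ˡ 1
  encode (edg i j) = (n ↑ʳ combine i j) ↑ˡ 1
  encode eps       = (n + S * m) ↑ʳ zero

  decode-encode : ∀ c → decode n m (encode c) ≡ c
  decode-encode (vert u)
    rewrite splitAt-↑ˡ (n + S * m) (u ↑ˡ S * m) 1 | splitAt-↑ˡ n u (S * m) = refl
  decode-encode (edg i j)
    rewrite splitAt-↑ˡ (n + S * m) (n ↑ʳ combine i j) 1 | splitAt-↑ʳ n (S * m) (combine i j)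
    = cong (λ (i′ , j′) → edg i′ j′) (remQuot-combine {S} {m} i j)
  decode-encode eps
    rewrite splitAt-↑ʳ (n + S * m) 1 zero = refl

  encode-decode : ∀ x → encode (decode n m x) ≡ x
  encode-decode x with splitAt (n + S * m) x in split₁
  ... | inj₂ zero = join-splitAt⁻¹ (n + S * m) 1 split₁
  ... | inj₁ y with splitAt n y in split₂
  ...   | inj₁ u = trans (cong (_↑ˡ 1) (join-splitAt⁻¹ n (S * m) split₂)) (join-splitAt⁻¹ (n + S * m) 1 split₁)
  ...   | inj₂ z = trans (cong (λ t → (n ↑ʳ t) ↑ˡ 1) (combine-remQuot {S} m z))
                    (trans (cong (_↑ˡ 1) (join-splitAt⁻¹ n (S * m) split₂)) (join-splitAt⁻¹ (n + S * m) 1 split₁))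

  card : (𝒱 → Bool) → ℕ
  card f = count (f ∘ vert) + ∑[ j < m ] count (λ i → f (edg i j)) + fromBool (f eps)

  card-cong : ∀ {f g} → (∀ c → f c ≡ g c) → card f ≡ card g
  card-cong f≗g = cong₂ _+_
    (cong₂ _+_ (sum-cong-≗ (cong fromBool ∘ f≗g ∘ vert))
               (sum-cong-≗ λ j → sum-cong-≗ λ i → cong fromBool (f≗g (edg i j))))
    (cong fromBool (f≗g eps))

  ∣F∣≡card : (F : Subset N) → ∣ F ∣ ≡ card (Vec.lookup F ∘ encode)
  ∣F∣≡card F = begin
    ∣ F ∣                                                        ≡⟨ ∣p∣≡count F ⟩
    sum G                                                        ≡⟨ sum-↑ (n + S * m) G ⟩
    ∑[ y < n + S * m ] G (y ↑ˡ 1) + (fromBool (f eps) + 0)        ≡⟨ cong₂ _+_ (sum-↑ n _) (+-identityʳ _) ⟩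
    count (f ∘ vert) + ∑[ z < S * m ] G ((n ↑ʳ z) ↑ˡ 1)
                     + fromBool (f eps)                          ≡⟨ cong (λ t → count (f ∘ vert) + t + fromBool (f eps))
                                                                         (trans (sum-combine S (G ∘ (_↑ˡ 1) ∘ (n ↑ʳ_)))
                                                                                (∑-comm (λ i j → fromBool (f (edg i j))))) ⟩
    card f                                                       ∎
    where
    open ≡-Reasoning
    f : 𝒱 → Bool
    f = Vec.lookup F ∘ encode
    G : Fin N → ℕ
    G = fromBool ∘ Vec.lookup F

  -- Column j is the path e⁰ — e¹ — ⋯ — e²ⁿ of copies of the j-th edge e; its apex e⁰ is also
  -- joined to both endpoints of e and to ε.
  edg-neighbour : ∀ {c j x} → CAdj es (edg c j) x →
      (c ≡ zero × (x ≡ vert (l j) ⊎ x ≡ vert (r j) ⊎ x ≡ eps))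
    ⊎ Σ (Fin (2 * n)) λ y → (c ≡ inject₁ y × x ≡ edg (suc y) j) ⊎ (c ≡ suc y × x ≡ edg (inject₁ y) j)
  edg-neighbour (inj₁ (path y j)) = inj₂ (y , inj₁ (refl , refl))
  edg-neighbour (inj₂ (endL j))   = inj₁ (refl , inj₁ refl)
  edg-neighbour (inj₂ (endR j))   = inj₁ (refl , inj₂ (inj₁ refl))
  edg-neighbour (inj₂ (path y j)) = inj₂ (y , inj₂ (refl , refl))
  edg-neighbour (inj₂ (toε j))    = inj₁ (refl , inj₂ (inj₂ refl))

  apex-neighbour : ∀ {j x} → CAdj es (edg zero j) x →
                   (x ≡ vert (l j) ⊎ x ≡ vert (r j) ⊎ x ≡ eps) ⊎ Σ (Fin S) (λ c → x ≡ edg c j)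
  apex-neighbour adj with edg-neighbour adj
  ... | inj₁ (_ , x∈ends)          = inj₁ x∈ends
  ... | inj₂ (y , inj₁ (_ , refl)) = inj₂ (suc y , refl)
  ... | inj₂ (y , inj₂ (() , _))

  column-adjacent : ∀ {i j} → suc i ≤ 2 * n → CAdj es (edg (clamp (2 * n) i) j) (edg (clamp (2 * n) (suc i)) j)
  column-adjacent {i} {j} i+1≤2n with clamp-step {2 * n} {i} i+1≤2n
  ... | x , i↦x , i+1↦x+1 rewrite i↦x | i+1↦x+1 = inj₁ (path x j)

  interior-neighbour : ∀ {i j x} → suc (suc i) ≤ 2 * n → CAdj es (edg (clamp (2 * n) (suc i)) j) x →
                       x ≡ edg (clamp (2 * n) i) j ⊎ x ≡ edg (clamp (2 * n) (suc (suc i))) j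
  interior-neighbour {i} {j} i+2≤2n adj
    with clamp-step {2 * n} {i} (<⇒≤ i+2≤2n) | clamp-step {2 * n} {suc i} i+2≤2n | edg-neighbour adj
  ... | _ , _ , i+1↦ | _ | inj₁ (c≡0 , _) = ⊥-elim (0≢1+nᶠ (trans (sym c≡0) i+1↦))
  ... | _ | x₂ , i+1↦ , i+2↦ | inj₂ (y , inj₁ (c≡y , refl)) =
    inj₂ (cong (λ z → edg z j) (trans (cong suc (inject₁-injective (trans (sym c≡y) i+1↦))) (sym i+2↦)))
  ... | x₁ , i↦ , i+1↦ | _ | inj₂ (y , inj₂ (c≡y , refl)) =
    inj₁ (cong (λ z → edg z j) (trans (cong inject₁ (suc-injectiveᶠ (trans (sym c≡y) i+1↦))) (sym i↦)))

  adjG-edge : ∀ {u v} → AdjG es u v → Σ (Fin m) λ j → (u ≡ l j × v ≡ r j) ⊎ (u ≡ r j × v ≡ l j)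
  adjG-edge (inj₁ uv∈es) = Any.index uv∈es , inj₁ (cong proj₁ (lookup-index uv∈es) , cong proj₂ (lookup-index uv∈es))
  adjG-edge (inj₂ vu∈es) = Any.index vu∈es , inj₂ (cong proj₂ (lookup-index vu∈es) , cong proj₁ (lookup-index vu∈es))

  independent-byEdges : (A : Subset n) → (∀ j → l j ∈ A → r j ∈ A → ⊥) → Independent (AdjG es) A
  independent-byEdges A noEdge u v u∈A v∈A uv with adjG-edge uv
  ... | j , inj₁ (refl , refl) = noEdge j u∈A v∈A
  ... | j , inj₂ (refl , refl) = noEdge j v∈A u∈A

  reach-invariant : ∀ {A : Set} (φ : Fin n → A) → (∀ j → φ (l j) ≡ φ (r j)) → ∀ {u v} → Reach es u v → φ u ≡ φ v
  reach-invariant φ φ-edge here = refl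
  reach-invariant φ φ-edge (step uv rest) with adjG-edge uv
  ... | j , inj₁ (refl , refl) = trans (φ-edge j) (reach-invariant φ φ-edge rest)
  ... | j , inj₂ (refl , refl) = trans (sym (φ-edge j)) (reach-invariant φ φ-edge rest)

  1≤maxIndependent : SimpleEdgeList n es → ∀ {k} → IsMaxCard (Independent (AdjG es)) k → Fin n → 1 ≤ k
  1≤maxIndependent (ordered , _) {k} (_ , maximal) u = subst (_≤ k) (∣⁅x⁆∣≡1 u) (maximal ⁅ u ⁆ singleton-independent)
    where
    noLoop : ∀ {v} → ¬ AdjG es v v
    noLoop (inj₁ vv∈es) = <ᶠ-irrefl refl (All.lookup ordered vv∈es)
    noLoop (inj₂ vv∈es) = <ᶠ-irrefl refl (All.lookup ordered vv∈es)
    singleton-independent : Independent (AdjG es) ⁅ u ⁆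
    singleton-independent v w v∈ w∈ with x∈⁅y⁆⇒x≡y u v∈ | x∈⁅y⁆⇒x≡y u w∈
    ... | refl | refl = noLoop

  columns-full : ∀ {f : 𝒱 → Bool} → (∀ j i → f (edg i j) ≡ true) → ∑[ j < m ] count (λ i → f (edg i j)) ≡ S * m
  columns-full {f} full = trans (sum-cong-≗ λ j → count-true (λ i → f (edg i j)) (full j)) (trans (sum-const m S) (*-comm m S))

  module LowerBound (I : Subset n) (independent : Independent (AdjG es) I) where

    g : 𝒱 → Bool
    g (vert u)  = Vec.lookup I u
    g (edg _ _) = true
    g eps       = false

    ε-empty : ∀ {u} → _≡_ {A = 𝒱} eps (vert u) ⊎ g eps ≡ true → ⊥
    ε-empty (inj₁ ())
    ε-empty (inj₂ ())

    g-skewForcingClosed : SkewForcingClosed (CAdj es) g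
    g-skewForcingClosed {v = edg _ _} _                nbrs = refl
    g-skewForcingClosed {v = vert _}  (inj₂ (endL j)) nbrs = ⊥-elim (ε-empty (nbrs eps (inj₂ (toε j))))
    g-skewForcingClosed {v = vert _}  (inj₂ (endR j)) nbrs = ⊥-elim (ε-empty (nbrs eps (inj₂ (toε j))))
    g-skewForcingClosed {v = eps}     (inj₂ (toε j))  nbrs =
      ⊥-elim (independent (l j) (r j) (endpoint∈I (nbrs _ (inj₂ (endL j)))) (endpoint∈I (nbrs _ (inj₂ (endR j))))
                          (inj₁ (∈-lookup j)))
      where
      endpoint∈I : ∀ {u : Fin n} → vert u ≡ eps ⊎ g (vert u) ≡ true → u ∈ I
      endpoint∈I (inj₂ Iu) = lookup⇒[]= _ I Iu

    Fᵍ : Subset N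
    Fᵍ = tabulate (g ∘ decode n m)

    lookup-Fᵍ : ∀ c → Vec.lookup Fᵍ (encode c) ≡ g c
    lookup-Fᵍ c = trans (lookup∘tabulate (g ∘ decode n m) (encode c)) (cong g (decode-encode c))

    Fᵍ-proper : Proper Fᵍ
    Fᵍ-proper Fᵍ≡⊤ = true≢false (sym (trans (sym (lookup-Fᵍ eps)) (trans ε-in-⊤ (lookup-replicate (encode eps) true))))
      where
      ε-in-⊤ : Vec.lookup Fᵍ (encode eps) ≡ Vec.lookup (Vec.replicate N true) (encode eps)
      ε-in-⊤ = cong (λ F → Vec.lookup F (encode eps)) Fᵍ≡⊤

    Fᵍ-skewStalled : SkewStalled (𝒢Adj es) Fᵍ
    Fᵍ-skewStalled = skewForcingClosed⇒skewStalled (CAdj es) (decode n m) encode decode-encode encode-decode g g-skewForcingClosed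

    ∣Fᵍ∣≡S*m+∣I∣ : ∣ Fᵍ ∣ ≡ S * m + ∣ I ∣
    ∣Fᵍ∣≡S*m+∣I∣ = begin
      ∣ Fᵍ ∣                                          ≡⟨ ∣F∣≡card Fᵍ ⟩
      card (Vec.lookup Fᵍ ∘ encode)                   ≡⟨ card-cong lookup-Fᵍ ⟩
      count (Vec.lookup I) + ∑[ j < m ] count {S} (λ _ → true) + 0
                                                      ≡⟨ cong₂ (λ a b → a + b + 0) (sym (∣p∣≡count I)) (columns-full {g} λ _ _ → refl) ⟩
      ∣ I ∣ + S * m + 0                               ≡⟨ +-identityʳ _ ⟩
      ∣ I ∣ + S * m                                   ≡⟨ +-comm ∣ I ∣ (S * m) ⟩
      S * m + ∣ I ∣                                   ∎
      where open ≡-Reasoning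

  module UpperBound (f : 𝒱 → Bool) (closed : ForcingClosed (CAdj es) f) where

    column : Fin m → ℕ → Bool
    column j i = f (edg (clamp (2 * n) i) j)

    column-closed : ∀ j i → suc (suc i) ≤ 2 * n → column j (suc i) ≡ true → column j i ≡ column j (suc (suc i))
    column-closed j i i+2≤2n fi+1 = forcingClosed-pair (CAdj es) f closed fi+1
      (swap (column-adjacent (<⇒≤ i+2≤2n))) (column-adjacent i+2≤2n)
      (λ x adj → [ inj₁ , inj₂ ∘ inj₁ ]′ (interior-neighbour i+2≤2n adj))

    column-sparse : ∀ {i₀ j} → f (edg i₀ j) ≡ false → count (λ i → f (edg i j)) ≤ suc n
    column-sparse {i₀} {j} empty = begin
      count (λ i → f (edg i j))   ≡⟨ sum-cong-≗ (λ i → cong (λ c → fromBool (f (edg c j))) (sym (clamp-toℕ i))) ⟩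
      countUpTo (column j) S      ≤⟨ countUpTo-noBothTrue (column j) n
                                       (false⇒noBothTrue (column j) (column-closed j) (toℕ≤pred[n] i₀) column-i₀) ⟩
      suc n                       ∎
      where
      open ≤-Reasoning
      column-i₀ : column j (toℕ i₀) ≡ false
      column-i₀ = trans (cong (λ c → f (edg c j)) (clamp-toℕ i₀)) empty

    apex-balanced : ∀ j → (∀ i → f (edg i j) ≡ true) → f eps ≡ true → f (vert (l j)) ≡ f (vert (r j))
    apex-balanced j full fε = forcingClosed-pair (CAdj es) f closed (full zero) (inj₂ (endL j)) (inj₂ (endR j)) nbrs
      where
      nbrs : ∀ x → CAdj es (edg zero j) x → x ≡ vert (l j) ⊎ x ≡ vert (r j) ⊎ f x ≡ true
      nbrs x adj with apex-neighbour adj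
      ... | inj₁ (inj₁ x≡l)         = inj₁ x≡l
      ... | inj₁ (inj₂ (inj₁ x≡r))  = inj₂ (inj₁ x≡r)
      ... | inj₁ (inj₂ (inj₂ refl)) = inj₂ (inj₂ fε)
      ... | inj₂ (c , refl)         = inj₂ (inj₂ (full c))

    apex-independent : ∀ j → (∀ i → f (edg i j) ≡ true) → f eps ≡ false →
                       f (vert (l j)) ≡ true → f (vert (r j)) ≡ true → ⊥
    apex-independent j full fε fl fr = true≢false (trans (sym (closed (full zero) (inj₂ (toε j)) nbrs)) fε)
      where
      nbrs : ∀ x → CAdj es (edg zero j) x → x ≡ eps ⊎ f x ≡ true
      nbrs x adj with apex-neighbour adj
      ... | inj₁ (inj₁ refl)        = inj₂ fl
      ... | inj₁ (inj₂ (inj₁ refl)) = inj₂ fr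
      ... | inj₁ (inj₂ (inj₂ x≡ε))  = inj₁ x≡ε
      ... | inj₂ (c , refl)         = inj₂ (full c)

    module _ (simple : SimpleEdgeList n es) (connected : Connected es) {k : ℕ}
             (maxIndependent : IsMaxCard (Independent (AdjG es)) k) (notFull : ¬ (∀ c → f c ≡ true)) where

      vertices≤k : (∀ j i → f (edg i j) ≡ true) → f eps ≡ false → count (f ∘ vert) ≤ k
      vertices≤k full fε = subst (_≤ k) ∣A∣≡count (proj₂ maxIndependent A (independent-byEdges A noEdge))
        where
        A : Subset n
        A = tabulate (f ∘ vert)
        ∈A⇒ : ∀ {u} → u ∈ A → f (vert u) ≡ true
        ∈A⇒ {u} u∈A = trans (sym (lookup∘tabulate (f ∘ vert) u)) ([]=⇒lookup u∈A)
        noEdge : ∀ j → l j ∈ A → r j ∈ A → ⊥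
        noEdge j l∈A r∈A = apex-independent j (full j) fε (∈A⇒ l∈A) (∈A⇒ r∈A)
        ∣A∣≡count : ∣ A ∣ ≡ count (f ∘ vert)
        ∣A∣≡count = trans (∣p∣≡count A) (sum-cong-≗ (cong fromBool ∘ lookup∘tabulate (f ∘ vert)))

      vertices-empty : (∀ j i → f (edg i j) ≡ true) → f eps ≡ true → Fin n × (∀ v → f (vert v) ≡ false)
      vertices-empty full fε with allTrue⊎someFalse (f ∘ vert)
      ... | inj₁ allV     = ⊥-elim (notFull λ { (vert u) → allV u ; (edg i j) → full j i ; eps → fε })
      ... | inj₂ (u , fu) = u , λ v → trans (sym (reach-invariant (f ∘ vert) balanced (connected u v))) fu
        where
        balanced : ∀ j → f (vert (l j)) ≡ f (vert (r j))
        balanced j = apex-balanced j (full j) fε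

      vertices+ε≤k : (∀ j i → f (edg i j) ≡ true) → count (f ∘ vert) + fromBool (f eps) ≤ k
      vertices+ε≤k full with f eps in fε
      ... | false = subst (_≤ k) (sym (+-identityʳ _)) (vertices≤k full fε)
      ... | true with vertices-empty full fε
      ...   | u , noVertices = subst (λ c → c + 1 ≤ k) (sym (count-false (f ∘ vert) noVertices))
                                     (1≤maxIndependent simple maxIndependent u)

      card≤-full : (∀ j i → f (edg i j) ≡ true) → card f ≤ S * m + k
      card≤-full full = begin
        count (f ∘ vert) + ∑[ j < m ] count (λ i → f (edg i j)) + fromBool (f eps)
                                                        ≡⟨ cong (λ t → count (f ∘ vert) + t + fromBool (f eps)) (columns-full {f} full) ⟩
        count (f ∘ vert) + S * m + fromBool (f eps)     ≡⟨ xy∙z≈y∙xz (count (f ∘ vert)) (S * m) _ ⟩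
        S * m + (count (f ∘ vert) + fromBool (f eps))   ≤⟨ +-monoʳ-≤ (S * m) (vertices+ε≤k full) ⟩
        S * m + k                                       ∎
        where open ≤-Reasoning

      card≤-sparse : ∀ {i₀ j₀} → f (edg i₀ j₀) ≡ false → card f ≤ S * m + k
      card≤-sparse {i₀} {j₀} empty = begin
        count (f ∘ vert) + columns + fromBool (f eps) ≤⟨ +-mono-≤ (+-monoˡ-≤ columns (count≤ (f ∘ vert))) (fromBool≤1 (f eps)) ⟩
        n + columns + 1                               ≡⟨ cong (_+ 1) (+-comm n columns) ⟩
        columns + n + 1                               ≤⟨ +-mono-≤ columns+n≤S*m (1≤maxIndependent simple maxIndependent (l j₀)) ⟩
        S * m + k                                     ∎
        where
        open ≤-Reasoning
        columns : ℕ
        columns = ∑[ j < m ] count (λ i → f (edg i j))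
        [1+n]+n≡S : suc n + n ≡ S
        [1+n]+n≡S = cong (λ t → suc (n + t)) (sym (+-identityʳ n))
        columns+n≤S*m : columns + n ≤ S * m
        columns+n≤S*m = begin
          columns + n          ≤⟨ sum-mono-≤-slack n (λ j → count≤ (λ i → f (edg i j))) j₀
                                    (≤-trans (+-monoˡ-≤ n (column-sparse empty)) (≤-reflexive [1+n]+n≡S)) ⟩
          ∑[ j < m ] S         ≡⟨ sum-const m S ⟩
          m * S                ≡⟨ *-comm m S ⟩
          S * m                ∎

      card≤ : card f ≤ S * m + k
      card≤ with allTrue⊎someFalse₂ (λ j i → f (edg i j))
      ... | inj₁ full              = card≤-full full
      ... | inj₂ (_ , _ , empty)   = card≤-sparse empty

  proper⇒notFull : (F : Subset N) → Proper F → ¬ (∀ c → Vec.lookup F (encode c) ≡ true)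
  proper⇒notFull F proper full = proper (⊆-antisym ⊆⊤ λ {x} _ →
    lookup⇒[]= x F (trans (cong (Vec.lookup F) (sym (encode-decode x))) (full (decode n m x))))

  upperBound : SimpleEdgeList n es → Connected es → ∀ {k} → IsMaxCard (Independent (AdjG es)) k →
               (F : Subset N) → Proper F → Stalled (𝒢Adj es) F → ∣ F ∣ ≤ S * m + k
  upperBound simple connected maxIndependent F proper stalled =
    subst (_≤ _) (sym (∣F∣≡card F))
      (UpperBound.card≤ (Vec.lookup F ∘ encode)
        (stalled⇒forcingClosed (CAdj es) (decode n m) encode decode-encode encode-decode F stalled)
        simple connected maxIndependent (proper⇒notFull F proper))

theorem1 : (n : ℕ) (es : List (Fin n × Fin n)) → SimpleEdgeList n es → Connected es →
           (k : ℕ) → IsMaxCard (Independent (AdjG es)) k →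
           IsMaxCard (λ F → Proper F × Stalled (𝒢Adj es) F) (suc (2 * n) * length es + k)
           × IsMaxCard (λ F → Proper F × SkewStalled (𝒢Adj es) F) (suc (2 * n) * length es + k)
theorem1 n es simple connected k maxIndependent@((I , independent , ∣I∣≡k) , _) =
    ( (Fᵍ , (Fᵍ-proper , skewStalled⇒stalled (𝒢Adj es) Fᵍ Fᵍ-skewStalled) , ∣Fᵍ∣≡S*m+k)
    , λ F (proper , stalled) → upper F proper stalled)
  , ( (Fᵍ , (Fᵍ-proper , Fᵍ-skewStalled) , ∣Fᵍ∣≡S*m+k)
    , λ F (proper , skew) → upper F proper (skewStalled⇒stalled (𝒢Adj es) F skew))
  where
  open Construction es
  open LowerBound I independent
  ∣Fᵍ∣≡S*m+k : ∣ Fᵍ ∣ ≡ S * m + k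
  ∣Fᵍ∣≡S*m+k = trans ∣Fᵍ∣≡S*m+∣I∣ (cong (S * m +_) ∣I∣≡k)
  upper : (F : Subset N) → Proper F → Stalled (𝒢Adj es) F → ∣ F ∣ ≤ S * m + k
  upper = upperBound simple connected maxIndependent
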